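{- Let $M$ be a matroid, let $S,T$ be disjoint subsets of $E(M)$, let $k := \kappa_M(S,T)$, and let $e \in E(M)- (S\cup T)$ be such that $\kappa_{M/e}(S,T) \neq k$. If $(A,B)$ is an $S$-$T$-separating partition of $E(M)$ of order $k+1$ such that $e\in A$ and $|A|$ is minimum among all such partitions, then $e\in\mathrm{cl}_M(A- e)\cap\mathrm{cl}_M(B)$.
   Context: For a matroid $M$ with ground set $E$, $\lambda_M(X) := r_M(X) + r_M(E- X) - r(M)$, and for disjoint $S,T\subseteq E$, $\kappa_M(S,T) := \min\{\lambda_M(X) : S \subseteq X \subseteq E- T\}$. A partition $(A,B)$ of $E(M)$ is $S$-$T$-separating of order $k+1$ if $S\subseteq A$, $T\subseteq B$ and $\lambda_M(A)=k$. $\mathrm{cl}_M$ denotes closure. -}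

module Defs where

open import Data.Nat using (ℕ; _+_; _∸_; _≤_)
open import Data.Fin using (Fin)
open import Data.Fin.Subset using (Subset; _∈_; _∉_; _⊆_; _∪_; _∩_; _─_; _-_; ⁅_⁆; ∣_∣; Empty)
open import Data.Product using (Σ; _×_; ∃)
open import Relation.Binary.PropositionalEquality using (_≡_)

-- A "rank structure" on the finite universe Fin n: a ground set E ⊆ Fin n
-- together with a rank function (only its values on subsets of E matter).
record RankData (n : ℕ) : Set where
  field
    E : Subset n
    r : Subset n → ℕ
open RankData public

record IsMatroid {n : ℕ} (M : RankData n) : Set where
  field
    r-bounded : ∀ X → X ⊆ E M → r M X ≤ ∣ X ∣
    r-mono    : ∀ X Y → X ⊆ Y → Y ⊆ E M → r M X ≤ r M Y
    r-submod  : ∀ X Y → X ⊆ E M → Y ⊆ E M →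
                r M (X ∪ Y) + r M (X ∩ Y) ≤ r M X + r M Y

Matroid : ℕ → Set
Matroid n = Σ (RankData n) IsMatroid

rM : ∀ {n} → RankData n → ℕ
rM M = r M (E M)

_／_ : ∀ {n} → RankData n → Fin n → RankData n
M ／ e = record { E = E M - e ; r = λ X → r M (X ∪ ⁅ e ⁆) ∸ r M ⁅ e ⁆ }

-- connectivity function λ_M(X) = r(X) + r(E - X) - r(M)
-- (always ≥ 0 for a matroid, so truncated subtraction is exact)
conn : ∀ {n} → RankData n → Subset n → ℕ
conn M X = (r M X + r M (E M ─ X)) ∸ rM M

IsKappa : ∀ {n} → RankData n → Subset n → Subset n → ℕ → Set
IsKappa M S T k =
  (∃ λ X → S ⊆ X × X ⊆ (E M ─ T) × conn M X ≡ k) ×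
  (∀ X → S ⊆ X → X ⊆ (E M ─ T) → k ≤ conn M X)

IsPartition : ∀ {n} → RankData n → Subset n → Subset n → Set
IsPartition M A B = (A ∪ B ≡ E M) × Empty (A ∩ B)

-- (A,B) is an S-T-separating partition of order j+1: S ⊆ A, T ⊆ B, λ(A) = j
IsSepPartition : ∀ {n} → RankData n → Subset n → Subset n →
                 ℕ → Subset n → Subset n → Set
IsSepPartition M S T j A B =
  IsPartition M A B × S ⊆ A × T ⊆ B × conn M A ≡ j

InCl : ∀ {n} → RankData n → Subset n → Fin n → Set
InCl M X x = x ∈ E M × r M (X ∪ ⁅ x ⁆) ≡ r M X

-- Contracting e changes connectivities only through r{e} ≤ 1, so λ_{M/e}(A − e) ≤ λ_M(A) = k;
-- as κ_{M/e}(S,T) ≠ k, some S–T-set Z of M/e has λ_{M/e}(Z) < k. Comparing this with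
-- λ_M(Z) ≥ k and λ_M(Z ∪ e) ≥ k forces r{e} = 1, e ∈ cl_M(E − e − Z) and λ_M(Z ∪ e) = k.
-- Uncrossing Z ∪ e with A (submodularity of λ) makes A ∩ (Z ∪ e) separating as well, so
-- minimality of |A| gives A ⊆ Z ∪ e; thus E − e − Z ⊆ B and e ∈ cl_M(B). Finally
-- λ_M(A − e) ≥ k together with r(B ∪ e) = r(B) yields r(A − e) = r(A). The existence of Z is
-- obtained by contradiction, which is constructive because closure membership is decidable.

module Submission where

open import Defs
open import Data.Nat using (ℕ; _≤_; _<_; _+_; _∸_; suc; s≤s; s≤s⁻¹)
open import Data.Nat.Properties
open import Data.Nat.Tactic.RingSolver using (solve-∀)
open import Data.Fin using (Fin)
open import Data.Fin.Subset using (Subset; _∈_; _∉_; _⊆_; _∪_; _∩_; _─_; _-_; ⁅_⁆; ∣_∣; Empty)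
open import Data.Fin.Subset.Properties
  using (_∈?_; ⊆-antisym; x∈p∪q⁺; x∈p∪q⁻; x∈p∩q⁺; x∈p∩q⁻; x∈p∧x∉q⇒x∈p─q; p─q⊆p;
         x∈⁅x⁆; x∈⁅y⁆⇒x≡y; ∣⁅x⁆∣≡1; p⊂q⇒∣p∣<∣q∣; p∩q⊆p)
open import Data.Vec using (_∷_; there)
open import Data.Product using (_×_; _,_; proj₁; proj₂)
open import Data.Sum using (inj₁; inj₂; [_,_])
open import Relation.Nullary using (¬_; Dec; yes; no; contradiction)
open import Relation.Nullary.Decidable using (_×-dec_; decidable-stable)
open import Relation.Binary.PropositionalEquality
  using (_≡_; refl; sym; trans; cong; cong₂; subst; subst₂; module ≡-Reasoning)

private variable
  n k : ℕ
  p q s : Subset n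
  x y : Fin n

∈-∪⁺ˡ : x ∈ p → x ∈ p ∪ q
∈-∪⁺ˡ x∈p = x∈p∪q⁺ (inj₁ x∈p)

∈-∪⁺ʳ : x ∈ q → x ∈ p ∪ q
∈-∪⁺ʳ x∈q = x∈p∪q⁺ (inj₂ x∈q)

∈-∩⁻ˡ : x ∈ p ∩ q → x ∈ p
∈-∩⁻ˡ {p = p} {q = q} x∈ = proj₁ (x∈p∩q⁻ p q x∈)

∈-∩⁻ʳ : x ∈ p ∩ q → x ∈ q
∈-∩⁻ʳ {p = p} {q = q} x∈ = proj₂ (x∈p∩q⁻ p q x∈)

∈-─⁺ : x ∈ p → x ∉ q → x ∈ p ─ q
∈-─⁺ = x∈p∧x∉q⇒x∈p─q

∈-─⁻ˡ : x ∈ p ─ q → x ∈ p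
∈-─⁻ˡ {p = p} {q = q} = p─q⊆p p q

∈-─⁻ʳ : x ∈ p ─ q → x ∉ q
∈-─⁻ʳ {p = _ ∷ p} {q = _ ∷ q} (there x∈) (there x∈q) = ∈-─⁻ʳ {p = p} {q = q} x∈ x∈q

∈-⁅⁆⁻ : x ∈ ⁅ y ⁆ → x ≡ y
∈-⁅⁆⁻ = x∈⁅y⁆⇒x≡y _

⁅⁆-⊆ : x ∈ p → ⁅ x ⁆ ⊆ p
⁅⁆-⊆ x∈p y∈⁅x⁆ = subst (_∈ _) (sym (∈-⁅⁆⁻ y∈⁅x⁆)) x∈p

∪-⊆ : p ⊆ s → q ⊆ s → p ∪ q ⊆ s
∪-⊆ {p = p} {q = q} p⊆s q⊆s x∈ = [ p⊆s , q⊆s ] (x∈p∪q⁻ p q x∈)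

p⊆q∪[p─q] : p ⊆ q ∪ (p ─ q)
p⊆q∪[p─q] {q = q} {x = x} x∈p with x ∈? q
... | yes x∈q = ∈-∪⁺ˡ x∈q
... | no  x∉q = ∈-∪⁺ʳ (∈-─⁺ x∈p x∉q)

q⊆p⇒q∪[p─q]≡p : q ⊆ p → q ∪ (p ─ q) ≡ p
q⊆p⇒q∪[p─q]≡p q⊆p = ⊆-antisym (∪-⊆ q⊆p ∈-─⁻ˡ) p⊆q∪[p─q]

p─[q∩s]⊆[p─q]∪[p─s] : p ─ (q ∩ s) ⊆ (p ─ q) ∪ (p ─ s)
p─[q∩s]⊆[p─q]∪[p─s] {q = q} {x = x} x∈ with x ∈? q
... | yes x∈q = ∈-∪⁺ʳ (∈-─⁺ (∈-─⁻ˡ x∈) (λ x∈s → ∈-─⁻ʳ x∈ (x∈p∩q⁺ (x∈q , x∈s))))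
... | no  x∉q = ∈-∪⁺ˡ (∈-─⁺ (∈-─⁻ˡ x∈) x∉q)

p─[q∪s]⊆[p─q]∩[p─s] : p ─ (q ∪ s) ⊆ (p ─ q) ∩ (p ─ s)
p─[q∪s]⊆[p─q]∩[p─s] x∈ = x∈p∩q⁺
  ( ∈-─⁺ (∈-─⁻ˡ x∈) (λ x∈q → ∈-─⁻ʳ x∈ (∈-∪⁺ˡ x∈q))
  , ∈-─⁺ (∈-─⁻ˡ x∈) (λ x∈s → ∈-─⁻ʳ x∈ (∈-∪⁺ʳ x∈s)))

p-x∪⁅x⁆≡p : x ∈ p → (p - x) ∪ ⁅ x ⁆ ≡ p
p-x∪⁅x⁆≡p {x = x} {p = p} x∈p = ⊆-antisym (∪-⊆ ∈-─⁻ˡ (⁅⁆-⊆ x∈p)) p⊆[p-x]∪⁅x⁆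
  where
  p⊆[p-x]∪⁅x⁆ : p ⊆ (p - x) ∪ ⁅ x ⁆
  p⊆[p-x]∪⁅x⁆ {y} y∈p with y ∈? ⁅ x ⁆
  ... | yes y∈⁅x⁆ = ∈-∪⁺ʳ y∈⁅x⁆
  ... | no  y∉⁅x⁆ = ∈-∪⁺ˡ (∈-─⁺ y∈p y∉⁅x⁆)

∣p∣≤∣p∩q∣⇒p⊆q : ∣ p ∣ ≤ ∣ p ∩ q ∣ → p ⊆ q
∣p∣≤∣p∩q∣⇒p⊆q {p = p} {q = q} ∣p∣≤ {x} x∈p with x ∈? q
... | yes x∈q = x∈q
... | no  x∉q = contradiction ∣p∣≤
      (<⇒≱ (p⊂q⇒∣p∣<∣q∣ (p∩q⊆p p q , x , x∈p , λ x∈p∩q → x∉q (∈-∩⁻ʳ x∈p∩q))))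

-- Used with a = r X, a′ = r (X ∪ e), b = r Y, b′ = r (Y ∪ e), ρe = r {e}, K = k + r(M).
contraction-squeeze : ∀ ρe {a a′ b b′ K} → ρe ≤ 1 → a ≤ a′ → b ≤ b′ →
  K ≤ a + b′ → K ≤ a′ + b → a′ + b′ < K + ρe → b′ ≡ b × a′ + b ≡ K
contraction-squeeze 0 _ a≤a′ _ K≤a+b′ _ a′+b′<K+0 =
  contradiction (≤-trans K≤a+b′ (+-monoˡ-≤ _ a≤a′))
    (<⇒≱ (subst (_ <_) (+-identityʳ _) a′+b′<K+0))
contraction-squeeze 1 {a′ = a′} {b} {b′} {K} _ _ b≤b′ _ K≤a′+b a′+b′<K+1 =
  b′≡b , ≤-antisym (≤-trans (+-monoʳ-≤ a′ b≤b′) a′+b′≤K) K≤a′+b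
  where
  a′+b′≤K : a′ + b′ ≤ K
  a′+b′≤K = s≤s⁻¹ (subst (a′ + b′ <_) (+-comm K 1) a′+b′<K+1)
  b′≡b : b′ ≡ b
  b′≡b = ≤-antisym (+-cancelˡ-≤ a′ _ _ (≤-trans a′+b′≤K K≤a′+b)) b≤b′
contraction-squeeze (suc (suc _)) (s≤s ())

-- The left-hand side is conn (M ／ e) X + r(M) + r{e} unfolded: p = r (X ∪ e), q = r (Y ∪ e), s = r(M).
∸-contraction : ∀ ρe {p q s} → ρe ≤ p → ρe ≤ q → ρe ≤ s → s + ρe ≤ p + q →
  (p ∸ ρe + (q ∸ ρe)) ∸ (s ∸ ρe) + s + ρe ≡ p + q
∸-contraction ρe ρe≤p ρe≤q ρe≤s s+ρe≤p+q
  with m≤n⇒∃[o]m+o≡n ρe≤p | m≤n⇒∃[o]m+o≡n ρe≤q | m≤n⇒∃[o]m+o≡n ρe≤s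
... | p , refl | q , refl | s , refl
  rewrite m+n∸m≡n ρe p | m+n∸m≡n ρe q | m+n∸m≡n ρe s = begin
    (p + q) ∸ s + (ρe + s) + ρe     ≡⟨ shuffle ((p + q) ∸ s) s ρe ⟩
    ((p + q) ∸ s + s) + (ρe + ρe)   ≡⟨ cong (_+ (ρe + ρe)) (m∸n+n≡m s≤p+q) ⟩
    (p + q) + (ρe + ρe)             ≡⟨ regroup p q ρe ⟩
    ρe + p + (ρe + q)               ∎
  where
  open ≡-Reasoning
  shuffle : ∀ t s ρe → t + (ρe + s) + ρe ≡ (t + s) + (ρe + ρe)
  shuffle = solve-∀
  regroup : ∀ p q ρe → (p + q) + (ρe + ρe) ≡ ρe + p + (ρe + q)
  regroup = solve-∀
  ρe-outside : ∀ s ρe → ρe + s + ρe ≡ s + (ρe + ρe)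
  ρe-outside = solve-∀
  s≤p+q : s ≤ p + q
  s≤p+q = +-cancelʳ-≤ (ρe + ρe) s (p + q)
    (subst₂ _≤_ (ρe-outside s ρe) (sym (regroup p q ρe)) s+ρe≤p+q)

InCl? : ∀ (N : RankData n) X x → Dec (InCl N X x)
InCl? N X x = x ∈? E N ×-dec r N (X ∪ ⁅ x ⁆) ≟ r N X

IsKappa-intro : ∀ {N : RankData n} {S T X} → S ⊆ X → X ⊆ E N ─ T → conn N X ≤ k →
  (∀ Z → S ⊆ Z → Z ⊆ E N ─ T → ¬ conn N Z < k) → IsKappa N S T k
IsKappa-intro {k = k} {N = N} {S} {T} {X} S⊆X X⊆E─T λX≤k never-below =
  (X , S⊆X , X⊆E─T , ≤-antisym λX≤k (k≤conn X S⊆X X⊆E─T)) , k≤conn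
  where
  k≤conn : ∀ Z → S ⊆ Z → Z ⊆ E N ─ T → k ≤ conn N Z
  k≤conn Z S⊆Z Z⊆E─T = ≮⇒≥ (never-below Z S⊆Z Z⊆E─T)

module Partition {N : RankData n} {A B : Subset n} (partition : IsPartition N A B) where

  partition-⊆ˡ : A ⊆ E N
  partition-⊆ˡ x∈A = subst (_ ∈_) (proj₁ partition) (∈-∪⁺ˡ x∈A)

  partition-⊆ʳ : B ⊆ E N
  partition-⊆ʳ x∈B = subst (_ ∈_) (proj₁ partition) (∈-∪⁺ʳ x∈B)

  partition-disjoint : x ∈ A → x ∉ B
  partition-disjoint x∈A x∈B = proj₂ partition (_ , x∈p∩q⁺ (x∈A , x∈B))

  partition-∉ˡ⇒∈ʳ : x ∈ E N → x ∉ A → x ∈ B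
  partition-∉ˡ⇒∈ʳ x∈E x∉A =
    [ (λ x∈A → contradiction x∈A x∉A) , (λ x∈B → x∈B) ]
      (x∈p∪q⁻ A B (subst (_ ∈_) (sym (proj₁ partition)) x∈E))

  partition-complement : B ≡ E N ─ A
  partition-complement = ⊆-antisym
    (λ x∈B → ∈-─⁺ (partition-⊆ʳ x∈B) (λ x∈A → partition-disjoint x∈A x∈B))
    (λ x∈ → partition-∉ˡ⇒∈ʳ (∈-─⁻ˡ x∈) (∈-─⁻ʳ x∈))

complement-partition : ∀ {N : RankData n} {X} → X ⊆ E N → IsPartition N X (E N ─ X)
complement-partition X⊆E =
  q⊆p⇒q∪[p─q]≡p X⊆E , λ (_ , x∈) → ∈-─⁻ʳ (∈-∩⁻ʳ x∈) (∈-∩⁻ˡ x∈)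

module _ {M : RankData n} (isMatroid : IsMatroid M) where
  open IsMatroid isMatroid
  open ≤-Reasoning

  r-submod-⊆ : ∀ {X Y P Q} → X ⊆ E M → Y ⊆ E M → P ⊆ X ∪ Y → Q ⊆ X ∩ Y →
               r M P + r M Q ≤ r M X + r M Y
  r-submod-⊆ {X} {Y} {P} {Q} X⊆E Y⊆E P⊆X∪Y Q⊆X∩Y = begin
    r M P + r M Q               ≤⟨ +-mono-≤ (r-mono P (X ∪ Y) P⊆X∪Y (∪-⊆ X⊆E Y⊆E))
                                             (r-mono Q (X ∩ Y) Q⊆X∩Y (λ x∈ → X⊆E (∈-∩⁻ˡ x∈))) ⟩
    r M (X ∪ Y) + r M (X ∩ Y)   ≤⟨ r-submod X Y X⊆E Y⊆E ⟩
    r M X + r M Y               ∎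

  r⁅x⁆≤1 : x ∈ E M → r M ⁅ x ⁆ ≤ 1
  r⁅x⁆≤1 {x = x} x∈E = subst (r M ⁅ x ⁆ ≤_) (∣⁅x⁆∣≡1 x) (r-bounded ⁅ x ⁆ (⁅⁆-⊆ x∈E))

  InCl-mono : ∀ {X Y} → X ⊆ Y → Y ⊆ E M → InCl M X x → InCl M Y x
  InCl-mono {x = x} {X} {Y} X⊆Y Y⊆E (x∈E , r[X+x]≡rX) =
    x∈E , ≤-antisym r[Y+x]≤rY (r-mono Y (Y ∪ ⁅ x ⁆) ∈-∪⁺ˡ Y+x⊆E)
    where
    Y+x⊆E : Y ∪ ⁅ x ⁆ ⊆ E M
    Y+x⊆E = ∪-⊆ Y⊆E (⁅⁆-⊆ x∈E)
    X+x⊆E : X ∪ ⁅ x ⁆ ⊆ E M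
    X+x⊆E = ∪-⊆ (λ x∈X → Y⊆E (X⊆Y x∈X)) (⁅⁆-⊆ x∈E)
    r[Y+x]≤rY : r M (Y ∪ ⁅ x ⁆) ≤ r M Y
    r[Y+x]≤rY = +-cancelʳ-≤ (r M X) _ _ (begin
      r M (Y ∪ ⁅ x ⁆) + r M X   ≤⟨ r-submod-⊆ Y⊆E X+x⊆E
                                     (∪-⊆ ∈-∪⁺ˡ (λ x∈⁅x⁆ → ∈-∪⁺ʳ (∈-∪⁺ʳ x∈⁅x⁆)))
                                     (λ x∈X → x∈p∩q⁺ (X⊆Y x∈X , ∈-∪⁺ˡ x∈X)) ⟩
      r M Y + r M (X ∪ ⁅ x ⁆)   ≡⟨ cong (r M Y +_) r[X+x]≡rX ⟩
      r M Y + r M X             ∎)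

  -- λ_M(X) + r(M), so that connectivities compare without truncated subtraction.
  connR : Subset n → ℕ
  connR X = r M X + r M (E M ─ X)

  rM≤connR : ∀ {X} → X ⊆ E M → rM M ≤ connR X
  rM≤connR X⊆E = m+n≤o⇒m≤o (rM M) (r-submod-⊆ X⊆E ∈-─⁻ˡ p⊆q∪[p─q] (λ x∈ → x∈))

  conn+rM≡connR : ∀ {X} → X ⊆ E M → conn M X + rM M ≡ connR X
  conn+rM≡connR X⊆E = m∸n+n≡m (rM≤connR X⊆E)

  ≤conn⇒≤connR : ∀ {X} → X ⊆ E M → k ≤ conn M X → k + rM M ≤ connR X
  ≤conn⇒≤connR {k = k} X⊆E k≤λX =
    subst (k + rM M ≤_) (conn+rM≡connR X⊆E) (+-monoˡ-≤ (rM M) k≤λX)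

  conn≡⇒connR≡ : ∀ {X} → X ⊆ E M → conn M X ≡ k → connR X ≡ k + rM M
  conn≡⇒connR≡ X⊆E λX≡k = trans (sym (conn+rM≡connR X⊆E)) (cong (_+ rM M) λX≡k)

  connR≡⇒conn≡ : ∀ {X} → connR X ≡ k + rM M → conn M X ≡ k
  connR≡⇒conn≡ {k = k} connR≡ = trans (cong (_∸ rM M) connR≡) (m+n∸n≡m k (rM M))

  connR-submod : ∀ {X Y} → X ⊆ E M → Y ⊆ E M →
                 connR (X ∪ Y) + connR (X ∩ Y) ≤ connR X + connR Y
  connR-submod {X} {Y} X⊆E Y⊆E = begin
    connR (X ∪ Y) + connR (X ∩ Y)
      ≡⟨ pair-up (r M (X ∪ Y)) _ _ _ ⟩
    (r M (X ∪ Y) + r M (X ∩ Y)) + (r M (E M ─ (X ∩ Y)) + r M (E M ─ (X ∪ Y)))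
      ≤⟨ +-mono-≤ (r-submod X Y X⊆E Y⊆E)
                  (r-submod-⊆ ∈-─⁻ˡ ∈-─⁻ˡ p─[q∩s]⊆[p─q]∪[p─s] p─[q∪s]⊆[p─q]∩[p─s]) ⟩
    (r M X + r M Y) + (r M (E M ─ X) + r M (E M ─ Y))
      ≡⟨ interchange (r M X) _ _ _ ⟩
    connR X + connR Y ∎
    where
    pair-up : ∀ a b c d → (a + d) + (b + c) ≡ (a + b) + (c + d)
    pair-up = solve-∀
    interchange : ∀ a b c d → (a + b) + (c + d) ≡ (a + c) + (b + d)
    interchange = solve-∀

  module _ {e : Fin n} (e∈E : e ∈ E M) where

    conn-／ : ∀ {X} → X ⊆ E M →
      conn (M ／ e) X + rM M + r M ⁅ e ⁆ ≡ r M (X ∪ ⁅ e ⁆) + r M (((E M - e) ─ X) ∪ ⁅ e ⁆)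
    conn-／ {X} X⊆E rewrite p-x∪⁅x⁆≡p e∈E =
      ∸-contraction (r M ⁅ e ⁆)
        (r-mono ⁅ e ⁆ _ ∈-∪⁺ʳ X+e⊆E) (r-mono ⁅ e ⁆ _ ∈-∪⁺ʳ Y+e⊆E) (r-mono ⁅ e ⁆ _ ⁅e⁆⊆E (λ x∈ → x∈))
        (r-submod-⊆ X+e⊆E Y+e⊆E E⊆X+e∪Y+e (λ x∈⁅e⁆ → x∈p∩q⁺ (∈-∪⁺ʳ x∈⁅e⁆ , ∈-∪⁺ʳ x∈⁅e⁆)))
      where
      ⁅e⁆⊆E : ⁅ e ⁆ ⊆ E M
      ⁅e⁆⊆E = ⁅⁆-⊆ e∈E
      X+e⊆E : X ∪ ⁅ e ⁆ ⊆ E M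
      X+e⊆E = ∪-⊆ X⊆E ⁅e⁆⊆E
      Y+e⊆E : ((E M - e) ─ X) ∪ ⁅ e ⁆ ⊆ E M
      Y+e⊆E = ∪-⊆ (λ x∈ → ∈-─⁻ˡ (∈-─⁻ˡ x∈)) ⁅e⁆⊆E
      E⊆X+e∪Y+e : E M ⊆ (X ∪ ⁅ e ⁆) ∪ (((E M - e) ─ X) ∪ ⁅ e ⁆)
      E⊆X+e∪Y+e {x} x∈E with x ∈? ⁅ e ⁆ | x ∈? X
      ... | yes x∈⁅e⁆ | _       = ∈-∪⁺ˡ (∈-∪⁺ʳ x∈⁅e⁆)
      ... | no  _     | yes x∈X = ∈-∪⁺ˡ (∈-∪⁺ˡ x∈X)
      ... | no  x∉⁅e⁆ | no  x∉X = ∈-∪⁺ʳ (∈-∪⁺ˡ (∈-─⁺ (∈-─⁺ x∈E x∉⁅e⁆) x∉X))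

    conn-／-drop : ∀ {X} → X ⊆ E M → k ≤ conn M X → k ≤ conn M (X ∪ ⁅ e ⁆) → conn (M ／ e) X < k →
      InCl M ((E M - e) ─ X) e × conn M (X ∪ ⁅ e ⁆) ≡ k
    conn-／-drop {k = k} {X} X⊆E k≤λX k≤λW λ′X<k =
      (e∈E , r[Y+e]≡rY) , connR≡⇒conn≡ (≤-antisym connR[W]≤ (≤conn⇒≤connR W⊆E k≤λW))
      where
      W Y : Subset n
      W = X ∪ ⁅ e ⁆
      Y = (E M - e) ─ X
      Y⊆E : Y ⊆ E M
      Y⊆E x∈ = ∈-─⁻ˡ (∈-─⁻ˡ x∈)
      W⊆E : W ⊆ E M
      W⊆E = ∪-⊆ X⊆E (⁅⁆-⊆ e∈E)
      Y+e⊆E : Y ∪ ⁅ e ⁆ ⊆ E M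
      Y+e⊆E = ∪-⊆ Y⊆E (⁅⁆-⊆ e∈E)
      E─X⊆Y+e : E M ─ X ⊆ Y ∪ ⁅ e ⁆
      E─X⊆Y+e {x} x∈ with x ∈? ⁅ e ⁆
      ... | yes x∈⁅e⁆ = ∈-∪⁺ʳ x∈⁅e⁆
      ... | no  x∉⁅e⁆ = ∈-∪⁺ˡ (∈-─⁺ (∈-─⁺ (∈-─⁻ˡ x∈) x∉⁅e⁆) (∈-─⁻ʳ x∈))
      E─W⊆Y : E M ─ W ⊆ Y
      E─W⊆Y x∈ = ∈-─⁺ (∈-─⁺ (∈-─⁻ˡ x∈) (λ x∈⁅e⁆ → ∈-─⁻ʳ x∈ (∈-∪⁺ʳ x∈⁅e⁆)))
                      (λ x∈X → ∈-─⁻ʳ x∈ (∈-∪⁺ˡ x∈X))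
      k≤λX⇒ : k + rM M ≤ r M X + r M (Y ∪ ⁅ e ⁆)
      k≤λX⇒ = ≤-trans (≤conn⇒≤connR X⊆E k≤λX) (+-monoʳ-≤ (r M X) (r-mono _ _ E─X⊆Y+e Y+e⊆E))
      k≤λW⇒ : k + rM M ≤ r M W + r M Y
      k≤λW⇒ = ≤-trans (≤conn⇒≤connR W⊆E k≤λW) (+-monoʳ-≤ (r M W) (r-mono _ _ E─W⊆Y Y⊆E))
      λ′X<k⇒ : r M W + r M (Y ∪ ⁅ e ⁆) < k + rM M + r M ⁅ e ⁆
      λ′X<k⇒ = begin-strict
        r M W + r M (Y ∪ ⁅ e ⁆)              ≡⟨ conn-／ X⊆E ⟨
        conn (M ／ e) X + rM M + r M ⁅ e ⁆   <⟨ +-monoˡ-< (r M ⁅ e ⁆) (+-monoˡ-< (rM M) λ′X<k) ⟩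
        k + rM M + r M ⁅ e ⁆                 ∎
      squeezed : r M (Y ∪ ⁅ e ⁆) ≡ r M Y × r M W + r M Y ≡ k + rM M
      squeezed = contraction-squeeze (r M ⁅ e ⁆) (r⁅x⁆≤1 e∈E) (r-mono X W ∈-∪⁺ˡ W⊆E)
        (r-mono Y (Y ∪ ⁅ e ⁆) ∈-∪⁺ˡ Y+e⊆E) k≤λX⇒ k≤λW⇒ λ′X<k⇒
      r[Y+e]≡rY : r M (Y ∪ ⁅ e ⁆) ≡ r M Y
      r[Y+e]≡rY = proj₁ squeezed
      connR[W]≤ : connR W ≤ k + rM M
      connR[W]≤ = ≤-trans (+-monoʳ-≤ (r M W) (r-mono _ _ E─W⊆Y Y⊆E)) (≤-reflexive (proj₂ squeezed))

  module _ {S T A B : Subset n} (sep : IsSepPartition M S T k A B) where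
    open Partition {N = M} {A} {B} (proj₁ sep)
    private
      S⊆A : S ⊆ A
      S⊆A = proj₁ (proj₂ sep)
      T⊆B : T ⊆ B
      T⊆B = proj₁ (proj₂ (proj₂ sep))
      λA≡k : conn M A ≡ k
      λA≡k = proj₂ (proj₂ (proj₂ sep))
      A⊆E─T : A ⊆ E M ─ T
      A⊆E─T x∈A = ∈-─⁺ (partition-⊆ˡ x∈A) (λ x∈T → partition-disjoint x∈A (T⊆B x∈T))

    rA+rB≡k+rM : r M A + r M B ≡ k + rM M
    rA+rB≡k+rM = subst (λ B′ → r M A + r M B′ ≡ _) (sym partition-complement)
                      (conn≡⇒connR≡ partition-⊆ˡ λA≡k)

    conn-／[A-e]≤k : ∀ {e} → e ∈ A → conn (M ／ e) (A - e) ≤ k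
    conn-／[A-e]≤k {e} e∈A = +-cancelʳ-≤ (rM M) _ _ (+-cancelʳ-≤ (r M ⁅ e ⁆) _ _ (begin
      conn (M ／ e) (A - e) + rM M + r M ⁅ e ⁆
        ≡⟨ conn-／ e∈E (λ x∈ → partition-⊆ˡ (∈-─⁻ˡ x∈)) ⟩
      r M ((A - e) ∪ ⁅ e ⁆) + r M (((E M - e) ─ (A - e)) ∪ ⁅ e ⁆)
        ≤⟨ +-mono-≤ (r-mono _ A (∪-⊆ ∈-─⁻ˡ (⁅⁆-⊆ e∈A)) partition-⊆ˡ)
                    (r-mono _ (B ∪ ⁅ e ⁆) (∪-⊆ (λ x∈ → ∈-∪⁺ˡ (outside-A-e x∈)) ∈-∪⁺ʳ) B+e⊆E) ⟩
      r M A + r M (B ∪ ⁅ e ⁆)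
        ≤⟨ +-monoʳ-≤ (r M A) (m+n≤o⇒m≤o _ (r-submod B ⁅ e ⁆ partition-⊆ʳ (⁅⁆-⊆ e∈E))) ⟩
      r M A + (r M B + r M ⁅ e ⁆)
        ≡⟨ +-assoc (r M A) _ _ ⟨
      r M A + r M B + r M ⁅ e ⁆
        ≡⟨ cong (_+ r M ⁅ e ⁆) rA+rB≡k+rM ⟩
      k + rM M + r M ⁅ e ⁆ ∎))
      where
      e∈E : e ∈ E M
      e∈E = partition-⊆ˡ e∈A
      B+e⊆E : B ∪ ⁅ e ⁆ ⊆ E M
      B+e⊆E = ∪-⊆ partition-⊆ʳ (⁅⁆-⊆ e∈E)
      outside-A-e : (E M - e) ─ (A - e) ⊆ B
      outside-A-e x∈ = partition-∉ˡ⇒∈ʳ (∈-─⁻ˡ (∈-─⁻ˡ x∈))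
        (λ x∈A → ∈-─⁻ʳ x∈ (∈-─⁺ x∈A (∈-─⁻ʳ (∈-─⁻ˡ x∈))))

    module _ (k≤conn : ∀ X → S ⊆ X → X ⊆ E M ─ T → k ≤ conn M X) where

      uncross : ∀ {W} → S ⊆ W → W ⊆ E M ─ T → conn M W ≡ k →
                IsSepPartition M S T k (A ∩ W) (E M ─ (A ∩ W))
      uncross {W} S⊆W W⊆E─T λW≡k =
        complement-partition {N = M} A∩W⊆E , S⊆A∩W , T⊆E─[A∩W] ,
        connR≡⇒conn≡ (≤-antisym connR[A∩W]≤ (≤conn⇒≤connR A∩W⊆E (k≤conn _ S⊆A∩W A∩W⊆E─T)))
        where
        W⊆E : W ⊆ E M
        W⊆E x∈W = ∈-─⁻ˡ (W⊆E─T x∈W)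
        S⊆A∩W : S ⊆ A ∩ W
        S⊆A∩W x∈S = x∈p∩q⁺ (S⊆A x∈S , S⊆W x∈S)
        A∩W⊆E─T : A ∩ W ⊆ E M ─ T
        A∩W⊆E─T x∈ = A⊆E─T (∈-∩⁻ˡ x∈)
        A∩W⊆E : A ∩ W ⊆ E M
        A∩W⊆E x∈ = partition-⊆ˡ (∈-∩⁻ˡ x∈)
        T⊆E─[A∩W] : T ⊆ E M ─ (A ∩ W)
        T⊆E─[A∩W] x∈T = ∈-─⁺ (partition-⊆ʳ (T⊆B x∈T))
                              (λ x∈ → partition-disjoint (∈-∩⁻ˡ x∈) (T⊆B x∈T))
        connR[A∪W]≥ : k + rM M ≤ connR (A ∪ W)
        connR[A∪W]≥ = ≤conn⇒≤connR (∪-⊆ partition-⊆ˡ W⊆E)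
          (k≤conn _ (λ x∈S → ∈-∪⁺ˡ (S⊆A x∈S)) (∪-⊆ A⊆E─T W⊆E─T))
        connR[A∩W]≤ : connR (A ∩ W) ≤ k + rM M
        connR[A∩W]≤ = +-cancelˡ-≤ (k + rM M) _ _ (begin
          k + rM M + connR (A ∩ W)       ≤⟨ +-monoˡ-≤ _ connR[A∪W]≥ ⟩
          connR (A ∪ W) + connR (A ∩ W)  ≤⟨ connR-submod partition-⊆ˡ W⊆E ⟩
          connR A + connR W              ≡⟨ cong₂ _+_ (conn≡⇒connR≡ partition-⊆ˡ λA≡k)
                                                      (conn≡⇒connR≡ W⊆E λW≡k) ⟩
          k + rM M + (k + rM M)          ∎)

      module _ {e : Fin n} (e∈A : e ∈ A) (e∉S∪T : e ∉ S ∪ T)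
               (minimal : ∀ A′ B′ → IsSepPartition M S T k A′ B′ → e ∈ A′ → ∣ A ∣ ≤ ∣ A′ ∣) where
        private
          e∈E : e ∈ E M
          e∈E = partition-⊆ˡ e∈A
          S⊆A-e : S ⊆ A - e
          S⊆A-e x∈S = ∈-─⁺ (S⊆A x∈S) (λ x∈⁅e⁆ → e∉S∪T (∈-∪⁺ˡ (subst (_∈ S) (∈-⁅⁆⁻ x∈⁅e⁆) x∈S)))
          A-e⊆E─T : A - e ⊆ E M ─ T
          A-e⊆E─T x∈ = A⊆E─T (∈-─⁻ˡ x∈)
          A-e⊆E′─T : A - e ⊆ E (M ／ e) ─ T
          A-e⊆E′─T x∈ = ∈-─⁺ (∈-─⁺ (∈-─⁻ˡ (A-e⊆E─T x∈)) (∈-─⁻ʳ x∈)) (∈-─⁻ʳ (A-e⊆E─T x∈))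

        InCl[B]⇒InCl[A-e] : InCl M B e → InCl M (A - e) e
        InCl[B]⇒InCl[A-e] (_ , r[B+e]≡rB) =
          e∈E , ≤-antisym (≤-trans (r-mono _ A A-e+e⊆A partition-⊆ˡ) rA≤r[A-e])
                          (r-mono (A - e) _ ∈-∪⁺ˡ (λ x∈ → partition-⊆ˡ (A-e+e⊆A x∈)))
          where
          A-e+e⊆A : (A - e) ∪ ⁅ e ⁆ ⊆ A
          A-e+e⊆A = ∪-⊆ ∈-─⁻ˡ (⁅⁆-⊆ e∈A)
          E─[A-e]⊆B+e : E M ─ (A - e) ⊆ B ∪ ⁅ e ⁆
          E─[A-e]⊆B+e {x} x∈ with x ∈? ⁅ e ⁆
          ... | yes x∈⁅e⁆ = ∈-∪⁺ʳ x∈⁅e⁆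
          ... | no  x∉⁅e⁆ = ∈-∪⁺ˡ (partition-∉ˡ⇒∈ʳ (∈-─⁻ˡ x∈) (λ x∈A → ∈-─⁻ʳ x∈ (∈-─⁺ x∈A x∉⁅e⁆)))
          rA≤r[A-e] : r M A ≤ r M (A - e)
          rA≤r[A-e] = +-cancelʳ-≤ (r M B) _ _ (begin
            r M A + r M B                   ≡⟨ rA+rB≡k+rM ⟩
            k + rM M                        ≤⟨ ≤conn⇒≤connR (λ x∈ → ∈-─⁻ˡ (A-e⊆E─T x∈))
                                                 (k≤conn (A - e) S⊆A-e A-e⊆E─T) ⟩
            connR (A - e)                   ≤⟨ +-monoʳ-≤ (r M (A - e))
                                                 (r-mono _ _ E─[A-e]⊆B+e (∪-⊆ partition-⊆ʳ (⁅⁆-⊆ e∈E))) ⟩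
            r M (A - e) + r M (B ∪ ⁅ e ⁆)   ≡⟨ cong (r M (A - e) +_) r[B+e]≡rB ⟩
            r M (A - e) + r M B             ∎)

        InCl-of-conn-／< : ∀ Z → S ⊆ Z → Z ⊆ E (M ／ e) ─ T → conn (M ／ e) Z < k →
                           InCl M (A - e) e × InCl M B e
        InCl-of-conn-／< Z S⊆Z Z⊆E′─T λ′Z<k = InCl[B]⇒InCl[A-e] InCl[B] , InCl[B]
          where
          W : Subset n
          W = Z ∪ ⁅ e ⁆
          Z⊆E : Z ⊆ E M
          Z⊆E x∈Z = ∈-─⁻ˡ (∈-─⁻ˡ (Z⊆E′─T x∈Z))
          Z⊆E─T : Z ⊆ E M ─ T
          Z⊆E─T x∈Z = ∈-─⁺ (Z⊆E x∈Z) (∈-─⁻ʳ (Z⊆E′─T x∈Z))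
          W⊆E─T : W ⊆ E M ─ T
          W⊆E─T = ∪-⊆ Z⊆E─T (⁅⁆-⊆ (∈-─⁺ e∈E (λ e∈T → e∉S∪T (∈-∪⁺ʳ e∈T))))
          S⊆W : S ⊆ W
          S⊆W x∈S = ∈-∪⁺ˡ (S⊆Z x∈S)
          dropped : InCl M ((E M - e) ─ Z) e × conn M W ≡ k
          dropped = conn-／-drop e∈E Z⊆E (k≤conn Z S⊆Z Z⊆E─T) (k≤conn W S⊆W W⊆E─T) λ′Z<k
          A⊆W : A ⊆ W
          A⊆W = ∣p∣≤∣p∩q∣⇒p⊆q
            (minimal _ _ (uncross S⊆W W⊆E─T (proj₂ dropped)) (x∈p∩q⁺ (e∈A , ∈-∪⁺ʳ (x∈⁅x⁆ e))))
          [E-e]─Z⊆B : (E M - e) ─ Z ⊆ B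
          [E-e]─Z⊆B x∈ = partition-∉ˡ⇒∈ʳ (∈-─⁻ˡ (∈-─⁻ˡ x∈)) λ x∈A →
            [ ∈-─⁻ʳ x∈ , ∈-─⁻ʳ (∈-─⁻ˡ x∈) ] (x∈p∪q⁻ Z ⁅ e ⁆ (A⊆W x∈A))
          InCl[B] : InCl M B e
          InCl[B] = InCl-mono [E-e]─Z⊆B partition-⊆ʳ (proj₁ dropped)

        IsKappa-／ : ¬ (InCl M (A - e) e × InCl M B e) → IsKappa (M ／ e) S T k
        IsKappa-／ ¬InCl = IsKappa-intro {N = M ／ e} S⊆A-e A-e⊆E′─T (conn-／[A-e]≤k e∈A)
          λ Z S⊆Z Z⊆E′─T λ′Z<k → ¬InCl (InCl-of-conn-／< Z S⊆Z Z⊆E′─T λ′Z<k)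

lemma3p5 : ∀ {n} (M : Matroid n) (S T : Subset n) (k : ℕ) (e : Fin n) (A B : Subset n) →
    S ⊆ E (proj₁ M) → T ⊆ E (proj₁ M) → Empty (S ∩ T) →
    IsKappa (proj₁ M) S T k →
    e ∈ E (proj₁ M) → e ∉ (S ∪ T) →
    ¬ IsKappa (proj₁ M ／ e) S T k →
    IsSepPartition (proj₁ M) S T k A B → e ∈ A →
    (∀ A′ B′ → IsSepPartition (proj₁ M) S T k A′ B′ → e ∈ A′ → ∣ A ∣ ≤ ∣ A′ ∣) →
    InCl (proj₁ M) (A - e) e × InCl (proj₁ M) B e
-- e ∈ E(M) follows from e ∈ A.
lemma3p5 (M , isMatroid) S T k e A B _ _ _ κ _ e∉S∪T ¬κ／ sep e∈A minimal =
  decidable-stable (InCl? M (A - e) e ×-dec InCl? M B e) λ ¬InCl →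
    ¬κ／ (IsKappa-／ isMatroid sep (proj₂ κ) e∈A e∉S∪T minimal ¬InCl)
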